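{- There is an absolute constant $C>0$ such that the following holds. Let $\mathcal{X}$ be a finite set, $s\ge1$ an integer, $\epsilon>0$, and $T:\mathcal{X}^s\times\{0,1\}^s\to[0,1]$ any function (an $s$-sample tester). Then there is a family $S_1,\dots,S_m$ of $m\le 2^{C\cdot 2^{2s}/\epsilon^2}$ subsets of $\mathcal{X}$ and a function $\varphi:[0,1]^m\to[0,1]$ such that for every $f:\mathcal{X}\to\{0,1\}$, \[\bigl|p_T(f)-\varphi(\mu_{S_1}(f),\dots,\mu_{S_m}(f))\bigr|\le\epsilon.\]
   Context: For $f:\mathcal{X}\to\{0,1\}$ and $\mathbf{x}=(x_1,\dots,x_s)\in\mathcal{X}^s$, $f(\mathbf{x})=(f(x_1),\dots,f(x_s))$; $T(\mathbf{x},\mathbf{y})$ is interpreted as the probability that the tester accepts when its samples are $\mathbf{x}$ with labels $\mathbf{y}$, and $p_T(f)=\mathbb{E}_{\mathbf{x}}[T(\mathbf{x},f(\mathbf{x}))]$ with $\mathbf{x}$ uniform in $\mathcal{X}^s$. For $S\subseteq\mathcal{X}$, $\mu_S(f)=\frac{1}{|S|}\sum_{x\in S}f(x)$ (taken to be $0$ if $S=\emptyset$).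
   Formalization: The accuracy ε and the values of the tester T are rational, and φ is replaced by a function on the rational points of $[0,1]^m$ with rational values. -}

module Defs where

open import Data.Bool using (Bool; true; false; if_then_else_)
open import Data.Nat as ℕ using (ℕ; suc)
open import Data.Integer as ℤ using (+_)
open import Data.Fin using (Fin)
open import Data.Fin.Subset using (Subset)
open import Data.Vec as Vec using (Vec; []; _∷_; lookup)
open import Data.List as List using (List; []; _∷_; filterᵇ; allFin; concatMap; length)
open import Data.Rational as ℚ using (ℚ; 0ℚ; 1ℚ; _+_; _*_; _/_; _÷_; ↥_; ↧ₙ_; _<_; >-nonZero)

sumℚ : List ℚ → ℚ
sumℚ []       = 0ℚ
sumℚ (q ∷ qs) = q + sumℚ qs

avg : List ℚ → ℚ
avg []         = 0ℚ
avg (q ∷ qs)   = sumℚ (q ∷ qs) * ((+ 1) / suc (length qs))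

allVecs : (n s : ℕ) → List (Vec (Fin n) s)
allVecs n 0       = [] ∷ []
allVecs n (suc s) = concatMap (λ x → List.map (x ∷_) (allVecs n s)) (allFin n)

applyVec : ∀ {n s} → (Fin n → Bool) → Vec (Fin n) s → Vec Bool s
applyVec f xs = Vec.map f xs

b2q : Bool → ℚ
b2q b = if b then 1ℚ else 0ℚ

Tester : ℕ → ℕ → Set
Tester n s = Vec (Fin n) s → Vec Bool s → ℚ

pT : ∀ {n s} → Tester n s → (Fin n → Bool) → ℚ
pT {n} {s} T f = avg (List.map (λ xs → T xs (applyVec f xs)) (allVecs n s))

elems : ∀ {n} → Subset n → List (Fin n)
elems {n} S = filterᵇ (lookup S) (allFin n)

-- μ_S(f) = (1/|S|) Σ_{x∈S} f(x), and 0 if S = ∅.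
μ : ∀ {n} → Subset n → (Fin n → Bool) → ℚ
μ S f = avg (List.map (λ x → b2q (f x)) (elems S))

expo : ℚ → ℕ → (ε : ℚ) → 0ℚ < ε → ℚ
expo C s ε ε>0 = ((C * ((+ (2 ℕ.^ (2 ℕ.* s))) / 1)) ÷ ε) ÷ ε
  where instance _ = >-nonZero ε>0

-- m ≤ 2^x for a nonnegative rational x = p/q (lowest terms): exactly m^q ≤ 2^p.
_≤2^_ : ℕ → ℚ → Set
m ≤2^ x = m ℕ.^ (↧ₙ x) ℕ.≤ 2 ℕ.^ ℤ.∣ ↥ x ∣

{-# OPTIONS --safe #-}
module Submission where

-- Regard T as a function on X^s × {0,1}^s and use the inner product ⟨u , v⟩ = |X|^-s Σ_{x,y} u v.
-- For f : X → {0,1} let 1_f(x , y) = [y = f(x)]; then p_T(f) = ⟨T , 1_f⟩, ‖1_f‖² = 1 and ‖T‖² ≤ 2^s.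
-- Greedily subtract from T the projection onto any 1_S with |⟨T , 1_S⟩| > ε: each step lowers ‖T‖²
-- by more than ε², so after k ≤ ⌈2^s / ε²⌉ steps p_T(f) is within ε of Σ_j c_j ⟨1_{S_j} , 1_f⟩ for every f.
-- Finally ⟨1_{S_j} , 1_f⟩ = |X|^-s a^s, where a = |S_j| μ_{S_j}(f) + |∁S_j| (1 - μ_{∁S_j}(f)) counts the
-- points on which f and S_j agree; so φ is a polynomial in the 2k means μ_{S_j}, μ_{∁S_j}, clamped to [0,1].

open import Function using (_∘_)
open import Data.Empty using (⊥-elim)
open import Data.Product using (Σ; Σ-syntax; ∃; ∃-syntax; _×_; _,_; proj₁; proj₂; uncurry)
open import Data.Sum using (inj₁; inj₂)
open import Data.Bool using (Bool; true; false; not; _∧_; T)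
import Data.Bool as Bool
open import Data.Nat as ℕ using (ℕ; zero; suc; z≤n; s≤s; NonZero)
import Data.Nat.Properties as ℕ
import Data.Nat.DivMod as ℕ
import Data.Nat.Coprimality as Coprime
import Data.Integer as ℤ
import Data.Integer.Properties as ℤ
open import Data.Rational as ℚ
  using (ℚ; mkℚ; 0ℚ; 1ℚ; _+_; _*_; _-_; -_; _/_; _÷_; 1/_; ∣_∣; _≤_; _<_; _⊔_; _⊓_; *≤*; *<*)
import Data.Rational.Properties as ℚ
open import Data.Rational.Solver using (module +-*-Solver)
open import Algebra.Definitions.RawSemiring ℚ.+-*-rawSemiring using (_^_)
open import Data.Fin using (Fin; zero; suc)
open import Data.Fin.Subset using (Subset; ∁)
open import Data.Fin.Subset.Properties using (anySubset?)
open import Data.Vec as Vec using (Vec; []; _∷_)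
import Data.Vec.Properties as Vec
open import Data.List as List using (List; []; _∷_; _++_; length; allFin; concatMap; cartesianProduct; filterᵇ)
import Data.List.Properties as List
open import Relation.Binary.PropositionalEquality
open import Relation.Binary.Definitions using (DecidableEquality)
open import Relation.Nullary using (yes; no; does; Dec)
open import Relation.Nullary.Decidable using (dec-true)
open import Relation.Unary using (Decidable)

open import Defs

private
  variable
    A B : Set

open +-*-Solver using (solve; _:+_; _:*_; _:-_; :-_; _:=_; con)

fromℕ : ℕ → ℚ
fromℕ k = ℤ.+ k / 1

fromℕ≡mkℚ : ∀ k → fromℕ k ≡ mkℚ (ℤ.+ k) 0 (Coprime.sym (Coprime.1-coprimeTo k))
fromℕ≡mkℚ k = ℚ.normalize-coprime _

fromℕ-+ : ∀ m n → fromℕ (m ℕ.+ n) ≡ fromℕ m + fromℕ n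
fromℕ-+ m n = sym (begin
  fromℕ m + fromℕ n                 ≡⟨ cong₂ _+_ (fromℕ≡mkℚ m) (fromℕ≡mkℚ n) ⟩
  (ℤ.+ m ℤ.* ℤ.+ 1 ℤ.+ ℤ.+ n ℤ.* ℤ.+ 1) / 1 ≡⟨ cong (_/ 1) (cong₂ ℤ._+_ (ℤ.*-identityʳ (ℤ.+ m)) (ℤ.*-identityʳ (ℤ.+ n))) ⟩
  fromℕ (m ℕ.+ n)                   ∎)
  where open ≡-Reasoning

fromℕ-suc : ∀ k → fromℕ (suc k) ≡ 1ℚ + fromℕ k
fromℕ-suc k = fromℕ-+ 1 k

fromℕ-* : ∀ m n → fromℕ (m ℕ.* n) ≡ fromℕ m * fromℕ n
fromℕ-* m n = sym (trans (cong₂ _*_ (fromℕ≡mkℚ m) (fromℕ≡mkℚ n)) (cong (_/ 1) (sym (ℤ.pos-* m n))))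

fromℕ-mono-≤ : ∀ {m n} → m ℕ.≤ n → fromℕ m ≤ fromℕ n
fromℕ-mono-≤ {m} {n} m≤n = subst₂ _≤_ (sym (fromℕ≡mkℚ m)) (sym (fromℕ≡mkℚ n))
  (*≤* (ℤ.*-monoʳ-≤-nonNeg (ℤ.+ 1) (ℤ.+≤+ m≤n)))

fromℕ-nonNeg : ∀ k → 0ℚ ≤ fromℕ k
fromℕ-nonNeg k = fromℕ-mono-≤ {0} {k} z≤n

fromℕ-*-inverse : ∀ k .{{_ : NonZero k}} → fromℕ k * (ℤ.+ 1 / k) ≡ 1ℚ
fromℕ-*-inverse (suc k) = trans
  (cong₂ _*_ (fromℕ≡mkℚ (suc k)) (ℚ.normalize-coprime (Coprime.1-coprimeTo (suc k))))
  (ℚ.*-inverseʳ (mkℚ (ℤ.+ suc k) 0 (Coprime.sym (Coprime.1-coprimeTo (suc k)))))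

∑ : List A → (A → ℚ) → ℚ
∑ xs h = sumℚ (List.map h xs)

module _ {h g : A → ℚ} where

  ∑-cong : ∀ xs → (∀ x → h x ≡ g x) → ∑ xs h ≡ ∑ xs g
  ∑-cong []       h≗g = refl
  ∑-cong (x ∷ xs) h≗g = cong₂ _+_ (h≗g x) (∑-cong xs h≗g)

  ∑-mono-≤ : ∀ xs → (∀ x → h x ≤ g x) → ∑ xs h ≤ ∑ xs g
  ∑-mono-≤ []       h≤g = ℚ.≤-refl
  ∑-mono-≤ (x ∷ xs) h≤g = ℚ.+-mono-≤ (h≤g x) (∑-mono-≤ xs h≤g)

  ∑-+ : ∀ xs → ∑ xs (λ x → h x + g x) ≡ ∑ xs h + ∑ xs g
  ∑-+ []       = refl
  ∑-+ (x ∷ xs) = trans (cong ((h x + g x) +_) (∑-+ xs)) (interchange (h x) (g x) _ _)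
    where
    interchange : ∀ a b c d → (a + b) + (c + d) ≡ (a + c) + (b + d)
    interchange = solve 4 (λ a b c d → (a :+ b) :+ (c :+ d) := (a :+ c) :+ (b :+ d)) refl

  ∑-- : ∀ xs → ∑ xs (λ x → h x - g x) ≡ ∑ xs h - ∑ xs g
  ∑-- []       = refl
  ∑-- (x ∷ xs) = trans (cong ((h x - g x) +_) (∑-- xs)) (interchange (h x) (g x) _ _)
    where
    interchange : ∀ a b c d → (a - b) + (c - d) ≡ (a + c) - (b + d)
    interchange = solve 4 (λ a b c d → (a :- b) :+ (c :- d) := (a :+ c) :- (b :+ d)) refl

∑-*ˡ : ∀ c xs (h : A → ℚ) → ∑ xs (λ x → c * h x) ≡ c * ∑ xs h
∑-*ˡ c []       h = sym (ℚ.*-zeroʳ c)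
∑-*ˡ c (x ∷ xs) h = trans (cong ((c * h x) +_) (∑-*ˡ c xs h)) (sym (ℚ.*-distribˡ-+ c (h x) (∑ xs h)))

∑-*ʳ : ∀ c xs (h : A → ℚ) → ∑ xs (λ x → h x * c) ≡ ∑ xs h * c
∑-*ʳ c xs h = trans (∑-cong xs (λ x → ℚ.*-comm (h x) c)) (trans (∑-*ˡ c xs h) (ℚ.*-comm c (∑ xs h)))

∑-const : ∀ c (xs : List A) → ∑ xs (λ _ → c) ≡ c * fromℕ (length xs)
∑-const c []       = sym (ℚ.*-zeroʳ c)
∑-const c (x ∷ xs) = begin
  c + ∑ xs (λ _ → c)             ≡⟨ cong (c +_) (∑-const c xs) ⟩
  c + c * fromℕ (length xs)      ≡⟨ distrib c (fromℕ (length xs)) ⟩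
  c * (1ℚ + fromℕ (length xs))   ≡⟨ cong (c *_) (sym (fromℕ-suc (length xs))) ⟩
  c * fromℕ (suc (length xs))    ∎
  where
  open ≡-Reasoning
  distrib : ∀ c k → c + c * k ≡ c * (1ℚ + k)
  distrib = solve 2 (λ c k → c :+ c :* k := c :* ((con 1ℚ) :+ k)) refl

∑-zero : ∀ (xs : List A) → ∑ xs (λ _ → 0ℚ) ≡ 0ℚ
∑-zero xs = trans (∑-const 0ℚ xs) (ℚ.*-zeroˡ (fromℕ (length xs)))

∑-*0 : ∀ xs (h : A → ℚ) → ∑ xs (λ x → h x * 0ℚ) ≡ 0ℚ
∑-*0 xs h = trans (∑-cong xs (λ x → ℚ.*-zeroʳ (h x))) (∑-zero xs)

∑-nonNeg : ∀ xs {h : A → ℚ} → (∀ x → 0ℚ ≤ h x) → 0ℚ ≤ ∑ xs h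
∑-nonNeg xs 0≤h = subst (_≤ ∑ xs _) (∑-zero xs) (∑-mono-≤ xs 0≤h)

∑-++ : ∀ xs ys (h : A → ℚ) → ∑ (xs ++ ys) h ≡ ∑ xs h + ∑ ys h
∑-++ []       ys h = sym (ℚ.+-identityˡ _)
∑-++ (x ∷ xs) ys h = trans (cong (h x +_) (∑-++ xs ys h)) (sym (ℚ.+-assoc (h x) _ _))

∑-map : ∀ (f : B → A) xs (h : A → ℚ) → ∑ (List.map f xs) h ≡ ∑ xs (h ∘ f)
∑-map f []       h = refl
∑-map f (x ∷ xs) h = cong (h (f x) +_) (∑-map f xs h)

∑-concatMap : ∀ (f : B → List A) xs (h : A → ℚ) → ∑ (concatMap f xs) h ≡ ∑ xs (λ x → ∑ (f x) h)
∑-concatMap f []       h = refl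
∑-concatMap f (x ∷ xs) h = trans (∑-++ (f x) (concatMap f xs) h) (cong (∑ (f x) h +_) (∑-concatMap f xs h))

∑-cartesianProduct : ∀ (xs : List A) (ys : List B) h →
  ∑ (cartesianProduct xs ys) h ≡ ∑ xs (λ x → ∑ ys (λ y → h (x , y)))
∑-cartesianProduct []       ys h = refl
∑-cartesianProduct (x ∷ xs) ys h = trans (∑-++ (List.map (x ,_) ys) _ h)
  (cong₂ _+_ (∑-map (x ,_) ys h) (∑-cartesianProduct xs ys h))

∑-partition : ∀ (p : A → Bool) (h : A → Bool → ℚ) xs →
  ∑ xs (λ x → h x (p x)) ≡ ∑ (filterᵇ p xs) (λ x → h x true) + ∑ (filterᵇ (not ∘ p) xs) (λ x → h x false)
∑-partition p h []       = refl
∑-partition p h (x ∷ xs) with p x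
... | true  = trans (cong (h x true +_) (∑-partition p h xs)) (sym (ℚ.+-assoc (h x true) _ _))
... | false = trans (cong (h x false +_) (∑-partition p h xs))
  (swap (h x false) (∑ (filterᵇ p xs) (λ x → h x true)) (∑ (filterᵇ (not ∘ p) xs) (λ x → h x false)))
  where
  swap : ∀ a b c → a + (b + c) ≡ b + (a + c)
  swap = solve 3 (λ a b c → a :+ (b :+ c) := b :+ (a :+ c)) refl

avg-map : ∀ (xs : List A) h .{{_ : NonZero (length xs)}} → avg (List.map h xs) ≡ ∑ xs h * (ℤ.+ 1 / length xs)
avg-map (x ∷ xs) h = cong (λ k → ∑ (x ∷ xs) h * (ℤ.+ 1 / suc k)) (List.length-map h xs)

∑≡length*avg : ∀ (xs : List A) h → ∑ xs h ≡ fromℕ (length xs) * avg (List.map h xs)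
∑≡length*avg []       h = sym (ℚ.*-zeroʳ (fromℕ 0))
∑≡length*avg (x ∷ xs) h = begin
  ∑ (x ∷ xs) h                           ≡⟨ sym (ℚ.*-identityˡ _) ⟩
  1ℚ * ∑ (x ∷ xs) h                      ≡⟨ cong (_* ∑ (x ∷ xs) h) (sym (fromℕ-*-inverse k)) ⟩
  fromℕ k * (ℤ.+ 1 / k) * ∑ (x ∷ xs) h   ≡⟨ rearrange (fromℕ k) _ _ ⟩
  fromℕ k * (∑ (x ∷ xs) h * (ℤ.+ 1 / k)) ≡⟨ cong (fromℕ k *_) (sym (avg-map (x ∷ xs) h)) ⟩
  fromℕ k * avg (List.map h (x ∷ xs))    ∎
  where
  open ≡-Reasoning
  k = length (x ∷ xs)
  rearrange : ∀ a b c → a * b * c ≡ a * (c * b)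
  rearrange = solve 3 (λ a b c → a :* b :* c := a :* (c :* b)) refl

0≤1 : 0ℚ ≤ 1ℚ
0≤1 = *≤* (ℤ.+≤+ z≤n)

*-nonNeg : ∀ {p q} → 0ℚ ≤ p → 0ℚ ≤ q → 0ℚ ≤ p * q
*-nonNeg {p} {q} 0≤p 0≤q = ℚ.nonNegative⁻¹ _
  {{ℚ.nonNeg*nonNeg⇒nonNeg p {{ℚ.nonNegative 0≤p}} q {{ℚ.nonNegative 0≤q}}}}

∣p∣*∣p∣≡p*p : ∀ p → ∣ p ∣ * ∣ p ∣ ≡ p * p
∣p∣*∣p∣≡p*p p with ℚ.∣p∣≡p∨∣p∣≡-p p
... | inj₁ ∣p∣≡p  rewrite ∣p∣≡p  = refl
... | inj₂ ∣p∣≡-p rewrite ∣p∣≡-p = neg*neg p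
  where
  neg*neg : ∀ p → - p * - p ≡ p * p
  neg*neg = solve 1 (λ p → :- p :* :- p := p :* p) refl

0≤p*p : ∀ p → 0ℚ ≤ p * p
0≤p*p p = subst (0ℚ ≤_) (∣p∣*∣p∣≡p*p p) (*-nonNeg (ℚ.0≤∣p∣ p) (ℚ.0≤∣p∣ p))

p*p≤1 : ∀ {p} → 0ℚ ≤ p → p ≤ 1ℚ → p * p ≤ 1ℚ
p*p≤1 {p} 0≤p p≤1 = ℚ.≤-trans (ℚ.*-monoˡ-≤-nonNeg p {{ℚ.nonNegative 0≤p}} p≤1) (subst (_≤ 1ℚ) (sym (ℚ.*-identityʳ p)) p≤1)

p≤∣p∣ : ∀ p → p ≤ ∣ p ∣
p≤∣p∣ p with ℚ.≤-total 0ℚ p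
... | inj₁ 0≤p = ℚ.≤-reflexive (sym (ℚ.0≤p⇒∣p∣≡p 0≤p))
... | inj₂ p≤0 = ℚ.≤-trans p≤0 (ℚ.0≤∣p∣ p)

0≤p-q : ∀ {p q} → q ≤ p → 0ℚ ≤ p - q
0≤p-q {p} {q} q≤p = subst (_≤ p - q) (ℚ.+-inverseʳ q) (ℚ.+-monoˡ-≤ (- q) q≤p)

∣p-r∣≤∣p-q∣ : ∀ {p q r} → q ≤ r → r ≤ p → ∣ p - r ∣ ≤ ∣ p - q ∣
∣p-r∣≤∣p-q∣ {p} {q} {r} q≤r r≤p = begin
  ∣ p - r ∣ ≡⟨ ℚ.0≤p⇒∣p∣≡p (0≤p-q r≤p) ⟩
  p - r     ≤⟨ ℚ.+-monoʳ-≤ p (ℚ.neg-antimono-≤ q≤r) ⟩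
  p - q     ≤⟨ p≤∣p∣ (p - q) ⟩
  ∣ p - q ∣ ∎
  where open ℚ.≤-Reasoning

∣p-r∣≤∣p-q∣′ : ∀ {p q r} → p ≤ r → r ≤ q → ∣ p - r ∣ ≤ ∣ p - q ∣
∣p-r∣≤∣p-q∣′ {p} {q} {r} p≤r r≤q = subst₂ _≤_ (∣-[p-q]∣ p r) (∣-[p-q]∣ p q)
  (∣p-r∣≤∣p-q∣ (ℚ.neg-antimono-≤ r≤q) (ℚ.neg-antimono-≤ p≤r))
  where
  neg-sub : ∀ p q → - p - - q ≡ - (p - q)
  neg-sub = solve 2 (λ p q → :- p :- :- q := :- (p :- q)) refl
  ∣-[p-q]∣ : ∀ p q → ∣ - p - - q ∣ ≡ ∣ p - q ∣
  ∣-[p-q]∣ p q = trans (cong ∣_∣ (neg-sub p q)) (ℚ.∣-p∣≡∣p∣ (p - q))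

p-q≤p : ∀ {p q} → 0ℚ ≤ q → p - q ≤ p
p-q≤p {p} 0≤q = subst (p - _ ≤_) (ℚ.+-identityʳ p) (ℚ.+-monoʳ-≤ p (ℚ.neg-antimono-≤ 0≤q))

p<∣q∣⇒p*p<q*q : ∀ {p q} → 0ℚ < p → p < ∣ q ∣ → p * p < q * q
p<∣q∣⇒p*p<q*q {p} {q} 0<p p<∣q∣ = begin-strict
  p * p         <⟨ ℚ.*-monoʳ-<-pos p {{ℚ.positive 0<p}} p<∣q∣ ⟩
  p * ∣ q ∣     <⟨ ℚ.*-monoˡ-<-pos ∣ q ∣ {{ℚ.positive (ℚ.<-trans 0<p p<∣q∣)}} p<∣q∣ ⟩
  ∣ q ∣ * ∣ q ∣ ≡⟨ ∣p∣*∣p∣≡p*p q ⟩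
  q * q         ∎
  where open ℚ.≤-Reasoning

clamp : ℚ → ℚ
clamp q = 0ℚ ⊔ (q ⊓ 1ℚ)

0≤clamp : ∀ q → 0ℚ ≤ clamp q
0≤clamp q = ℚ.p≤p⊔q 0ℚ (q ⊓ 1ℚ)

clamp≤1 : ∀ q → clamp q ≤ 1ℚ
clamp≤1 q = ℚ.⊔-lub 0≤1 (ℚ.p⊓q≤q q 1ℚ)

clamp-nonexpansive : ∀ {p} → 0ℚ ≤ p → p ≤ 1ℚ → ∀ q → ∣ p - clamp q ∣ ≤ ∣ p - q ∣
clamp-nonexpansive 0≤p p≤1 q with ℚ.≤-total q 1ℚ
... | inj₂ 1≤q rewrite ℚ.p≥q⇒p⊓q≡q 1≤q = ∣p-r∣≤∣p-q∣′ p≤1 1≤q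
... | inj₁ q≤1 rewrite ℚ.p≤q⇒p⊓q≡p q≤1 with ℚ.≤-total 0ℚ q
...   | inj₁ 0≤q rewrite ℚ.p≤q⇒p⊔q≡q 0≤q = ℚ.≤-refl
...   | inj₂ q≤0 rewrite ℚ.p≥q⇒p⊔q≡p q≤0 = ∣p-r∣≤∣p-q∣ q≤0 0≤p

module InnerProduct {A : Set} (dom : List A) (w : A → ℚ) where

  ⟨_,_⟩ : (A → ℚ) → (A → ℚ) → ℚ
  ⟨ u , v ⟩ = ∑ dom (λ a → w a * (u a * v a))

  ‖_‖² : (A → ℚ) → ℚ
  ‖ u ‖² = ⟨ u , u ⟩

  ⟨⟩-congʳ : ∀ u {v v′} → (∀ a → v a ≡ v′ a) → ⟨ u , v ⟩ ≡ ⟨ u , v′ ⟩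
  ⟨⟩-congʳ u v≗v′ = ∑-cong dom (λ a → cong (λ x → w a * (u a * x)) (v≗v′ a))

  ⟨⟩-comm : ∀ u v → ⟨ u , v ⟩ ≡ ⟨ v , u ⟩
  ⟨⟩-comm u v = ∑-cong dom (λ a → cong (w a *_) (ℚ.*-comm (u a) (v a)))

  ⟨-⟩ˡ : ∀ u c k v → ⟨ (λ a → u a - c * k a) , v ⟩ ≡ ⟨ u , v ⟩ - c * ⟨ k , v ⟩
  ⟨-⟩ˡ u c k v = begin
    ⟨ (λ a → u a - c * k a) , v ⟩                            ≡⟨ ∑-cong dom (λ a → distrib (w a) (u a) c (k a) (v a)) ⟩
    ∑ dom (λ a → w a * (u a * v a) - c * (w a * (k a * v a))) ≡⟨ ∑-- dom ⟩
    ⟨ u , v ⟩ - ∑ dom (λ a → c * (w a * (k a * v a)))         ≡⟨ cong (λ x → ⟨ u , v ⟩ - x) (∑-*ˡ c dom _) ⟩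
    ⟨ u , v ⟩ - c * ⟨ k , v ⟩                                 ∎
    where
    open ≡-Reasoning
    distrib : ∀ w u c k v → w * ((u - c * k) * v) ≡ w * (u * v) - c * (w * (k * v))
    distrib = solve 5 (λ w u c k v → w :* ((u :- c :* k) :* v) := w :* (u :* v) :- c :* (w :* (k :* v))) refl

  ‖u-ck‖² : ∀ u c k → ‖ (λ a → u a - c * k a) ‖² ≡ ‖ u ‖² - (c + c) * ⟨ u , k ⟩ + c * c * ‖ k ‖²
  ‖u-ck‖² u c k = begin
    ⟨ u′ , u′ ⟩                                  ≡⟨ ⟨-⟩ˡ u c k u′ ⟩
    ⟨ u , u′ ⟩ - c * ⟨ k , u′ ⟩                  ≡⟨ cong₂ (λ x y → x - c * y) (⟨⟩-comm u u′) (⟨⟩-comm k u′) ⟩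
    ⟨ u′ , u ⟩ - c * ⟨ u′ , k ⟩                  ≡⟨ cong₂ (λ x y → x - c * y) (⟨-⟩ˡ u c k u) (⟨-⟩ˡ u c k k) ⟩
    ‖ u ‖² - c * ⟨ k , u ⟩ - c * (r - c * N)     ≡⟨ cong (λ x → ‖ u ‖² - c * x - c * (r - c * N)) (⟨⟩-comm k u) ⟩
    ‖ u ‖² - c * r - c * (r - c * N)             ≡⟨ collect ‖ u ‖² c r N ⟩
    ‖ u ‖² - (c + c) * r + c * c * N             ∎
    where
    open ≡-Reasoning
    u′ = λ a → u a - c * k a
    r = ⟨ u , k ⟩
    N = ‖ k ‖²
    collect : ∀ E c r N → E - c * r - c * (r - c * N) ≡ E - (c + c) * r + c * c * N
    collect = solve 4 (λ E c r N → E :- c :* r :- c :* (r :- c :* N) := E :- (c :+ c) :* r :+ c :* c :* N) refl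

  module _ (w≥0 : ∀ a → 0ℚ ≤ w a) where

    ‖‖²-nonNeg : ∀ u → 0ℚ ≤ ‖ u ‖²
    ‖‖²-nonNeg u = ∑-nonNeg dom (λ a → *-nonNeg (w≥0 a) (0≤p*p (u a)))

    module Greedy {I : Set} (K : I → A → ℚ) (‖K‖²≤1 : ∀ i → ‖ K i ‖² ≤ 1ℚ)
                  (any? : ∀ {P : I → Set} → Decidable P → Dec (∃ P)) where

      _⊖_ : (A → ℚ) → List (ℚ × I) → (A → ℚ)
      u ⊖ []             = u
      u ⊖ ((c , i) ∷ cs) = (λ a → u a - c * K i a) ⊖ cs

      ⟨⊖⟩ : ∀ u cs v → ⟨ u ⊖ cs , v ⟩ ≡ ⟨ u , v ⟩ - ∑ cs (λ (c , i) → c * ⟨ K i , v ⟩)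
      ⟨⊖⟩ u []             v = sym (ℚ.+-identityʳ ⟨ u , v ⟩)
      ⟨⊖⟩ u ((c , i) ∷ cs) v = begin
        ⟨ u′ ⊖ cs , v ⟩                              ≡⟨ ⟨⊖⟩ u′ cs v ⟩
        ⟨ u′ , v ⟩ - rest                            ≡⟨ cong (_- rest) (⟨-⟩ˡ u c (K i) v) ⟩
        ⟨ u , v ⟩ - c * ⟨ K i , v ⟩ - rest           ≡⟨ sub-sub ⟨ u , v ⟩ _ rest ⟩
        ⟨ u , v ⟩ - (c * ⟨ K i , v ⟩ + rest)         ∎
        where
        open ≡-Reasoning
        u′ = λ a → u a - c * K i a
        rest = ∑ cs (λ (c , i) → c * ⟨ K i , v ⟩)
        sub-sub : ∀ x y z → x - y - z ≡ x - (y + z)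
        sub-sub = solve 3 (λ x y z → x :- y :- z := x :- (y :+ z)) refl

      ‖u⊖proj‖²≤ : ∀ u i → let r = ⟨ u , K i ⟩ in ‖ u ⊖ ((r , i) ∷ []) ‖² ≤ ‖ u ‖² - r * r
      ‖u⊖proj‖²≤ u i = begin
        ‖ u ⊖ ((r , i) ∷ []) ‖²                  ≡⟨ ‖u-ck‖² u r (K i) ⟩
        ‖ u ‖² - (r + r) * r + r * r * ‖ K i ‖²   ≡⟨ regroup ‖ u ‖² r ‖ K i ‖² ⟩
        ‖ u ‖² - r * r - r * r * (1ℚ - ‖ K i ‖²)  ≤⟨ p-q≤p (*-nonNeg (0≤p*p r) (0≤p-q (‖K‖²≤1 i))) ⟩
        ‖ u ‖² - r * r                            ∎
        where
        open ℚ.≤-Reasoning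
        r = ⟨ u , K i ⟩
        regroup : ∀ E r N → E - (r + r) * r + r * r * N ≡ E - r * r - r * r * (1ℚ - N)
        regroup = solve 3 (λ E r N → E :- (r :+ r) :* r :+ r :* r :* N := E :- r :* r :- r :* r :* ((con 1ℚ) :- N)) refl

      module _ {ε} (0<ε : 0ℚ < ε) where

        Approximates : (A → ℚ) → Set
        Approximates u = ∀ i → ∣ ⟨ u , K i ⟩ ∣ ≤ ε

        greedy : ∀ k u → ‖ u ‖² ≤ fromℕ k * (ε * ε) →
                 Σ[ cs ∈ List (ℚ × I) ] length cs ℕ.≤ k × Approximates (u ⊖ cs)
        greedy k u ‖u‖²≤ with any? (λ i → ε ℚ.<? ∣ ⟨ u , K i ⟩ ∣)
        ... | no ∄i = [] , z≤n , λ i → ℚ.≮⇒≥ (λ ε<∣r∣ → ∄i (i , ε<∣r∣))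
        ... | yes (i , ε<∣r∣) = continue k ‖u‖²≤
          where
          r = ⟨ u , K i ⟩
          u′ = u ⊖ ((r , i) ∷ [])

          ‖u′‖²< : ∀ k → ‖ u ‖² ≤ fromℕ k * (ε * ε) → ‖ u′ ‖² < fromℕ k * (ε * ε) - ε * ε
          ‖u′‖²< k ‖u‖²≤ = begin-strict
            ‖ u′ ‖²                       ≤⟨ ‖u⊖proj‖²≤ u i ⟩
            ‖ u ‖² - r * r                <⟨ ℚ.+-monoʳ-< ‖ u ‖² (ℚ.neg-antimono-< (p<∣q∣⇒p*p<q*q 0<ε ε<∣r∣)) ⟩
            ‖ u ‖² - ε * ε                ≤⟨ ℚ.+-monoˡ-≤ (- (ε * ε)) ‖u‖²≤ ⟩
            fromℕ k * (ε * ε) - ε * ε     ∎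
            where open ℚ.≤-Reasoning

          budget : ∀ k → fromℕ (suc k) * (ε * ε) - ε * ε ≡ fromℕ k * (ε * ε)
          budget k = trans (cong (λ x → x * (ε * ε) - ε * ε) (fromℕ-suc k)) (cancel (fromℕ k) (ε * ε))
            where
            cancel : ∀ k e → (1ℚ + k) * e - e ≡ k * e
            cancel = solve 2 (λ k e → ((con 1ℚ) :+ k) :* e :- e := k :* e) refl

          continue : ∀ k → ‖ u ‖² ≤ fromℕ k * (ε * ε) →
                     Σ[ cs ∈ List (ℚ × I) ] length cs ℕ.≤ k × Approximates (u ⊖ cs)
          continue zero ‖u‖²≤ = ⊥-elim (ℚ.<-irrefl refl (begin-strict
            0ℚ           ≤⟨ ‖‖²-nonNeg u′ ⟩
            ‖ u′ ‖²       <⟨ subst (‖ u′ ‖² <_) (zero-budget (ε * ε)) (‖u′‖²< zero ‖u‖²≤) ⟩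
            - (ε * ε)    ≤⟨ ℚ.neg-antimono-≤ (0≤p*p ε) ⟩
            0ℚ           ∎))
            where
            open ℚ.≤-Reasoning
            zero-budget : ∀ e → 0ℚ * e - e ≡ - e
            zero-budget = solve 1 (λ e → (con 0ℚ) :* e :- e := :- e) refl
          continue (suc k) ‖u‖²≤ =
            let cs , length≤k , approx = greedy k u′ (ℚ.<⇒≤ (subst (‖ u′ ‖² <_) (budget k) (‖u′‖²< (suc k) ‖u‖²≤)))
            in (r , i) ∷ cs , s≤s length≤k , approx

𝟙[_] : ∀ {P : Set} → Dec P → ℚ
𝟙[ P? ] = b2q (does P?)

b2q-∧ : ∀ a b → b2q (a ∧ b) ≡ b2q a * b2q b
b2q-∧ true  b = sym (ℚ.*-identityˡ (b2q b))
b2q-∧ false b = sym (ℚ.*-zeroˡ (b2q b))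

_≟ᵛ_ : ∀ {s} → DecidableEquality (Vec Bool s)
_≟ᵛ_ = Vec.≡-dec Bool._≟_

allLabels : ∀ s → List (Vec Bool s)
allLabels zero    = [] ∷ []
allLabels (suc s) = List.map (true ∷_) (allLabels s) ++ List.map (false ∷_) (allLabels s)

length-allLabels : ∀ s → length (allLabels s) ≡ 2 ℕ.^ s
length-allLabels zero    = refl
length-allLabels (suc s) = begin
  length (List.map (true ∷_) L ++ List.map (false ∷_) L)        ≡⟨ List.length-++ (List.map (true ∷_) L) ⟩
  length (List.map (true ∷_) L) ℕ.+ length (List.map (false ∷_) L) ≡⟨ cong₂ ℕ._+_ (List.length-map _ L) (List.length-map _ L) ⟩
  length L ℕ.+ length L                                           ≡⟨ cong (λ l → l ℕ.+ l) (length-allLabels s) ⟩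
  2 ℕ.^ s ℕ.+ 2 ℕ.^ s                                             ≡⟨ cong (2 ℕ.^ s ℕ.+_) (sym (ℕ.+-identityʳ (2 ℕ.^ s))) ⟩
  2 ℕ.^ suc s                                                     ∎
  where
  open ≡-Reasoning
  L = allLabels s

∑-allLabels-suc : ∀ s (h : Vec Bool (suc s) → ℚ) →
  ∑ (allLabels (suc s)) h ≡ ∑ (allLabels s) (h ∘ (true ∷_)) + ∑ (allLabels s) (h ∘ (false ∷_))
∑-allLabels-suc s h = trans (∑-++ (List.map (true ∷_) (allLabels s)) _ h)
  (cong₂ _+_ (∑-map (true ∷_) (allLabels s) h) (∑-map (false ∷_) (allLabels s) h))

∑-select : ∀ s (h : Vec Bool s → ℚ) z → ∑ (allLabels s) (λ y → h y * 𝟙[ y ≟ᵛ z ]) ≡ h z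
∑-select zero    h []         = trans (ℚ.+-identityʳ _) (ℚ.*-identityʳ (h []))
∑-select (suc s) h (true ∷ z)  = trans (∑-allLabels-suc s _)
  (trans (cong₂ _+_ (∑-select s (h ∘ (true ∷_)) z) (∑-*0 (allLabels s) (h ∘ (false ∷_)))) (ℚ.+-identityʳ _))
∑-select (suc s) h (false ∷ z) = trans (∑-allLabels-suc s _)
  (trans (cong₂ _+_ (∑-*0 (allLabels s) (h ∘ (true ∷_))) (∑-select s (h ∘ (false ∷_)) z)) (ℚ.+-identityˡ _))

∏ : ∀ {s} → Vec A s → (A → ℚ) → ℚ
∏ []       h = 1ℚ
∏ (x ∷ xs) h = h x * ∏ xs h

𝟙-applyVec : ∀ {n s} (f g : Fin n → Bool) (xs : Vec (Fin n) s) →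
  𝟙[ applyVec f xs ≟ᵛ applyVec g xs ] ≡ ∏ xs (λ a → 𝟙[ f a Bool.≟ g a ])
𝟙-applyVec f g []       = refl
𝟙-applyVec f g (x ∷ xs) = trans (b2q-∧ (does (f x Bool.≟ g x)) _) (cong (𝟙[ f x Bool.≟ g x ] *_) (𝟙-applyVec f g xs))

∑-allVecs-∏ : ∀ n s (h : Fin n → ℚ) → ∑ (allVecs n s) (λ xs → ∏ xs h) ≡ ∑ (allFin n) h ^ s
∑-allVecs-∏ n zero    h = ℚ.+-identityʳ 1ℚ
∑-allVecs-∏ n (suc s) h = begin
  ∑ (concatMap (λ a → List.map (a ∷_) V) (allFin n)) (λ xs → ∏ xs h) ≡⟨ ∑-concatMap _ (allFin n) _ ⟩
  ∑ (allFin n) (λ a → ∑ (List.map (a ∷_) V) (λ xs → ∏ xs h))       ≡⟨ ∑-cong (allFin n) (λ a → ∑-map (a ∷_) V _) ⟩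
  ∑ (allFin n) (λ a → ∑ V (λ xs → h a * ∏ xs h))                   ≡⟨ ∑-cong (allFin n) (λ a → ∑-*ˡ (h a) V _) ⟩
  ∑ (allFin n) (λ a → h a * ∑ V (λ xs → ∏ xs h))                   ≡⟨ ∑-*ʳ _ (allFin n) h ⟩
  ∑ (allFin n) h * ∑ V (λ xs → ∏ xs h)                             ≡⟨ cong (∑ (allFin n) h *_) (∑-allVecs-∏ n s h) ⟩
  ∑ (allFin n) h ^ suc s                                           ∎
  where
  open ≡-Reasoning
  V = allVecs n s

length-allVecs : ∀ n s → length (allVecs n s) ≡ n ℕ.^ s
length-allVecs n zero    = refl
length-allVecs n (suc s) = trans (length-prefix (allFin n))
  (cong₂ ℕ._*_ (List.length-tabulate {n = n} (λ a → a)) (length-allVecs n s))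
  where
  V = allVecs n s
  length-prefix : ∀ as → length (concatMap (λ a → List.map (a ∷_) V) as) ≡ length as ℕ.* length V
  length-prefix []       = refl
  length-prefix (a ∷ as) = trans (List.length-++ (List.map (a ∷_) V))
    (cong₂ ℕ._+_ (List.length-map (a ∷_) V) (length-prefix as))

MeanApproximation : ∀ {n s} → Tester n s → ℚ → ℕ → Set
MeanApproximation {n} T ε m =
  Σ (Fin m → Subset n) λ S → Σ ((Fin m → ℚ) → ℚ) λ φ →
    ((v : Fin m → ℚ) → ((i : Fin m) → (0ℚ ≤ v i) × (v i ≤ 1ℚ)) → (0ℚ ≤ φ v) × (φ v ≤ 1ℚ)) ×
    ((f : Fin n → Bool) → ∣ pT T f - φ (λ i → μ (S i) f) ∣ ≤ ε)

module Samples (n s : ℕ) .{{_ : NonZero n}} where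

  Sample : Set
  Sample = Vec (Fin n) s × Vec Bool s

  samples : List Sample
  samples = cartesianProduct (allVecs n s) (allLabels s)

  M : ℕ
  M = length (allVecs n s)

  instance
    M≢0 : NonZero M
    M≢0 = subst NonZero (sym (length-allVecs n s)) (ℕ.m^n≢0 n s)

  w : ℚ
  w = ℤ.+ 1 / M

  open InnerProduct samples (λ _ → w)

  labelledBy : (Fin n → Bool) → Sample → ℚ
  labelledBy g (xs , ys) = 𝟙[ ys ≟ᵛ applyVec g xs ]

  labelledBy-cong : ∀ {g g′} → (∀ a → g a ≡ g′ a) → ∀ p → labelledBy g p ≡ labelledBy g′ p
  labelledBy-cong g≗g′ (xs , ys) = cong (λ zs → 𝟙[ ys ≟ᵛ zs ]) (Vec.map-cong g≗g′ xs)

  ⟨u,labelledBy⟩ : ∀ u g → ⟨ u , labelledBy g ⟩ ≡ w * ∑ (allVecs n s) (λ xs → u (xs , applyVec g xs))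
  ⟨u,labelledBy⟩ u g = begin
    ⟨ u , labelledBy g ⟩                                                   ≡⟨ ∑-cartesianProduct (allVecs n s) (allLabels s) _ ⟩
    ∑ (allVecs n s) (λ xs → ∑ (allLabels s) (λ ys → w * (u (xs , ys) * 𝟙[ ys ≟ᵛ applyVec g xs ]))) ≡⟨ ∑-cong (allVecs n s) select ⟩
    ∑ (allVecs n s) (λ xs → w * u (xs , applyVec g xs))                    ≡⟨ ∑-*ˡ w (allVecs n s) _ ⟩
    w * ∑ (allVecs n s) (λ xs → u (xs , applyVec g xs))                    ∎
    where
    open ≡-Reasoning
    select : ∀ xs → ∑ (allLabels s) (λ ys → w * (u (xs , ys) * 𝟙[ ys ≟ᵛ applyVec g xs ])) ≡ w * u (xs , applyVec g xs)
    select xs = trans (∑-cong (allLabels s) (λ ys → sym (ℚ.*-assoc w (u (xs , ys)) _)))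
                      (∑-select s (λ ys → w * u (xs , ys)) (applyVec g xs))

  w*M≡1 : w * fromℕ M ≡ 1ℚ
  w*M≡1 = trans (ℚ.*-comm w (fromℕ M)) (fromℕ-*-inverse M)

  0≤w : 0ℚ ≤ w
  0≤w = ℚ.nonNegative⁻¹ w {{ℚ.normalize-nonNeg 1 M}}

  w*∑1≡1 : w * ∑ (allVecs n s) (λ _ → 1ℚ) ≡ 1ℚ
  w*∑1≡1 = trans (cong (w *_) (trans (∑-const 1ℚ (allVecs n s)) (ℚ.*-identityˡ (fromℕ M)))) w*M≡1

  w*∑∈[0,1] : ∀ (h : Vec (Fin n) s → ℚ) → (∀ xs → (0ℚ ≤ h xs) × (h xs ≤ 1ℚ)) →
              (0ℚ ≤ w * ∑ (allVecs n s) h) × (w * ∑ (allVecs n s) h ≤ 1ℚ)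
  w*∑∈[0,1] h h∈[0,1] =
    *-nonNeg 0≤w (∑-nonNeg (allVecs n s) (proj₁ ∘ h∈[0,1])) ,
    subst (w * ∑ (allVecs n s) h ≤_) w*∑1≡1
      (ℚ.*-monoˡ-≤-nonNeg w {{ℚ.nonNegative 0≤w}} (∑-mono-≤ (allVecs n s) (proj₂ ∘ h∈[0,1])))

  pT≡w*∑ : ∀ (T : Tester n s) f → pT T f ≡ w * ∑ (allVecs n s) (λ xs → T xs (applyVec f xs))
  pT≡w*∑ T f = trans (avg-map (allVecs n s) _) (ℚ.*-comm _ w)

  pT≡⟨T,labelledBy⟩ : ∀ (T : Tester n s) f → pT T f ≡ ⟨ uncurry T , labelledBy f ⟩
  pT≡⟨T,labelledBy⟩ T f = trans (pT≡w*∑ T f) (sym (⟨u,labelledBy⟩ (uncurry T) f))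

  pT∈[0,1] : ∀ (T : Tester n s) → (∀ xs ys → (0ℚ ≤ T xs ys) × (T xs ys ≤ 1ℚ)) →
             ∀ f → (0ℚ ≤ pT T f) × (pT T f ≤ 1ℚ)
  pT∈[0,1] T T∈[0,1] f = subst (λ p → (0ℚ ≤ p) × (p ≤ 1ℚ)) (sym (pT≡w*∑ T f))
    (w*∑∈[0,1] _ (λ xs → T∈[0,1] xs (applyVec f xs)))

  ‖labelledBy‖²≡1 : ∀ g → ‖ labelledBy g ‖² ≡ 1ℚ
  ‖labelledBy‖²≡1 g = trans (⟨u,labelledBy⟩ (labelledBy g) g) (trans (cong (w *_) (∑-cong (allVecs n s) 𝟙-refl)) w*∑1≡1)
    where
    𝟙-refl : ∀ xs → 𝟙[ applyVec g xs ≟ᵛ applyVec g xs ] ≡ 1ℚ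
    𝟙-refl xs = cong b2q (dec-true (applyVec g xs ≟ᵛ applyVec g xs) refl)

  ‖u‖²≤2^s : ∀ u → (∀ x → (0ℚ ≤ u x) × (u x ≤ 1ℚ)) → ‖ u ‖² ≤ fromℕ (2 ℕ.^ s)
  ‖u‖²≤2^s u u∈[0,1] = begin
    ‖ u ‖²                                            ≤⟨ ∑-mono-≤ samples w*u*u≤w ⟩
    ∑ samples (λ _ → w)                               ≡⟨ ∑-cartesianProduct (allVecs n s) (allLabels s) _ ⟩
    ∑ (allVecs n s) (λ _ → ∑ (allLabels s) (λ _ → w)) ≡⟨ ∑-cong (allVecs n s) (λ _ → ∑-const w (allLabels s)) ⟩
    ∑ (allVecs n s) (λ _ → w * L)                     ≡⟨ ∑-const (w * L) (allVecs n s) ⟩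
    w * L * fromℕ M                                   ≡⟨ rearrange w L (fromℕ M) ⟩
    w * fromℕ M * L                                   ≡⟨ trans (cong (_* L) w*M≡1) (ℚ.*-identityˡ L) ⟩
    L                                                 ≡⟨ cong fromℕ (length-allLabels s) ⟩
    fromℕ (2 ℕ.^ s)                                   ∎
    where
    open ℚ.≤-Reasoning
    L = fromℕ (length (allLabels s))
    w*u*u≤w : ∀ x → w * (u x * u x) ≤ w
    w*u*u≤w x = subst (w * (u x * u x) ≤_) (ℚ.*-identityʳ w)
      (ℚ.*-monoˡ-≤-nonNeg w {{ℚ.nonNegative 0≤w}} (p*p≤1 (proj₁ (u∈[0,1] x)) (proj₂ (u∈[0,1] x))))
    rearrange : ∀ w l m → w * l * m ≡ w * m * l
    rearrange = solve 3 (λ w l m → w :* l :* m := w :* m :* l) refl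

  agreement : (Fin n → Bool) → (Fin n → Bool) → ℚ
  agreement f g = ∑ (allFin n) (λ a → 𝟙[ f a Bool.≟ g a ])

  ⟨labelledBy,labelledBy⟩ : ∀ g f → ⟨ labelledBy g , labelledBy f ⟩ ≡ w * agreement f g ^ s
  ⟨labelledBy,labelledBy⟩ g f = begin
    ⟨ labelledBy g , labelledBy f ⟩                                 ≡⟨ ⟨u,labelledBy⟩ (labelledBy g) f ⟩
    w * ∑ (allVecs n s) (λ xs → 𝟙[ applyVec f xs ≟ᵛ applyVec g xs ]) ≡⟨ cong (w *_) (∑-cong (allVecs n s) (𝟙-applyVec f g)) ⟩
    w * ∑ (allVecs n s) (λ xs → ∏ xs (λ a → 𝟙[ f a Bool.≟ g a ]))   ≡⟨ cong (w *_) (∑-allVecs-∏ n s _) ⟩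
    w * agreement f g ^ s                                           ∎
    where open ≡-Reasoning

  size : Subset n → ℚ
  size S = fromℕ (length (elems S))

  agreementFromMeans : Subset n → ℚ → ℚ → ℚ
  agreementFromMeans S μS μ∁S = size S * μS + size (∁ S) * (1ℚ - μ∁S)

  agreement≡agreementFromMeans : ∀ f S → agreement f (Vec.lookup S) ≡ agreementFromMeans S (μ S f) (μ (∁ S) f)
  agreement≡agreementFromMeans f S =
    trans (∑-partition (Vec.lookup S) (λ a b → 𝟙[ f a Bool.≟ b ]) (allFin n)) (cong₂ _+_ on-S on-∁S)
    where
    open ≡-Reasoning
    on-S : ∑ (elems S) (λ a → 𝟙[ f a Bool.≟ true ]) ≡ size S * μ S f
    on-S = trans (∑-cong (elems S) (𝟙[≟true] ∘ f)) (∑≡length*avg (elems S) (b2q ∘ f))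
      where
      𝟙[≟true] : ∀ b → 𝟙[ b Bool.≟ true ] ≡ b2q b
      𝟙[≟true] true  = refl
      𝟙[≟true] false = refl

    on-∁S : ∑ (filterᵇ (not ∘ Vec.lookup S) (allFin n)) (λ a → 𝟙[ f a Bool.≟ false ]) ≡ size (∁ S) * (1ℚ - μ (∁ S) f)
    on-∁S = begin
      ∑ (filterᵇ (not ∘ Vec.lookup S) (allFin n)) (λ a → 𝟙[ f a Bool.≟ false ]) ≡⟨ cong (λ xs → ∑ xs _) elems-∁ ⟩
      ∑ (elems (∁ S)) (λ a → 𝟙[ f a Bool.≟ false ])                  ≡⟨ ∑-cong (elems (∁ S)) (𝟙[≟false] ∘ f) ⟩
      ∑ (elems (∁ S)) (λ a → 1ℚ - b2q (f a))                         ≡⟨ ∑-- (elems (∁ S)) ⟩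
      ∑ (elems (∁ S)) (λ _ → 1ℚ) - ∑ (elems (∁ S)) (b2q ∘ f)         ≡⟨ cong (_- ∑ (elems (∁ S)) (b2q ∘ f)) (∑-const 1ℚ (elems (∁ S))) ⟩
      1ℚ * size (∁ S) - ∑ (elems (∁ S)) (b2q ∘ f)                    ≡⟨ cong (λ x → 1ℚ * size (∁ S) - x) (∑≡length*avg (elems (∁ S)) (b2q ∘ f)) ⟩
      1ℚ * size (∁ S) - size (∁ S) * μ (∁ S) f                       ≡⟨ factor (size (∁ S)) (μ (∁ S) f) ⟩
      size (∁ S) * (1ℚ - μ (∁ S) f)                                  ∎
      where
      elems-∁ : filterᵇ (not ∘ Vec.lookup S) (allFin n) ≡ elems (∁ S)
      elems-∁ = List.filter-≐ _ _
        ((λ {a} → subst T (sym (Vec.lookup-map a not S))) , (λ {a} → subst T (Vec.lookup-map a not S))) (allFin n)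
      𝟙[≟false] : ∀ b → 𝟙[ b Bool.≟ false ] ≡ 1ℚ - b2q b
      𝟙[≟false] true  = refl
      𝟙[≟false] false = refl
      factor : ∀ k m → 1ℚ * k - k * m ≡ k * (1ℚ - m)
      factor = solve 2 (λ k m → con 1ℚ :* k :- k :* m := k :* (con 1ℚ :- m)) refl

  queries : List (ℚ × Subset n) → List (Subset n)
  queries []             = []
  queries ((_ , S) ∷ cs) = S ∷ ∁ S ∷ queries cs

  length-queries : ∀ cs → length (queries cs) ≡ 2 ℕ.* length cs
  length-queries []       = refl
  length-queries (_ ∷ cs) = trans (cong (2 ℕ.+_) (length-queries cs)) (sym (ℕ.*-suc 2 (length cs)))

  estimate : ∀ cs → (Fin (length (queries cs)) → ℚ) → ℚ
  estimate []             v = 0ℚ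
  estimate ((c , S) ∷ cs) v =
    c * (w * agreementFromMeans S (v zero) (v (suc zero)) ^ s) + estimate cs (λ i → v (suc (suc i)))

  estimate-μ : ∀ cs f → estimate cs (λ i → μ (List.lookup (queries cs) i) f)
                        ≡ ∑ cs (λ (c , S) → c * ⟨ labelledBy (Vec.lookup S) , labelledBy f ⟩)
  estimate-μ []             f = refl
  estimate-μ ((c , S) ∷ cs) f = cong₂ (λ x y → c * x + y)
    (sym (trans (⟨labelledBy,labelledBy⟩ (Vec.lookup S) f) (cong (λ a → w * a ^ s) (agreement≡agreementFromMeans f S))))
    (estimate-μ cs f)

  open Greedy (λ _ → 0≤w) (labelledBy ∘ Vec.lookup) (ℚ.≤-reflexive ∘ ‖labelledBy‖²≡1 ∘ Vec.lookup) anySubset?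

  module _ (T : Tester n s) (T∈[0,1] : ∀ xs ys → (0ℚ ≤ T xs ys) × (T xs ys ≤ 1ℚ)) {ε} (0<ε : 0ℚ < ε) where

    approximation : ∀ k → fromℕ (2 ℕ.^ s) ≤ fromℕ k * (ε * ε) → Σ[ m ∈ ℕ ] m ℕ.≤ 2 ℕ.* k × MeanApproximation T ε m
    approximation k 2^s≤kε² = fromGreedy (greedy 0<ε k T̂ (ℚ.≤-trans (‖u‖²≤2^s T̂ (uncurry T∈[0,1])) 2^s≤kε²))
      where
      T̂ = uncurry T

      fromGreedy : Σ[ cs ∈ List (ℚ × Subset n) ] length cs ℕ.≤ k × Approximates 0<ε (T̂ ⊖ cs) →
                   Σ[ m ∈ ℕ ] m ℕ.≤ 2 ℕ.* k × MeanApproximation T ε m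
      fromGreedy (cs , length≤k , approx) =
        length (queries cs) , subst (ℕ._≤ 2 ℕ.* k) (sym (length-queries cs)) (ℕ.*-monoʳ-≤ 2 length≤k) ,
        S , clamp ∘ estimate cs , (λ v _ → 0≤clamp (estimate cs v) , clamp≤1 (estimate cs v)) , close
        where
        S = List.lookup (queries cs)
        close : ∀ f → ∣ pT T f - clamp (estimate cs (λ i → μ (S i) f)) ∣ ≤ ε
        close f = begin
          ∣ pT T f - clamp (estimate cs μs) ∣                        ≤⟨ clamp-nonexpansive 0≤pT pT≤1 (estimate cs μs) ⟩
          ∣ pT T f - estimate cs μs ∣                                ≡⟨ cong ∣_∣ residual ⟩
          ∣ ⟨ T̂ ⊖ cs , labelledBy f ⟩ ∣                              ≡⟨ cong ∣_∣ via-tabulate ⟨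
          ∣ ⟨ T̂ ⊖ cs , labelledBy (Vec.lookup (Vec.tabulate f)) ⟩ ∣ ≤⟨ approx (Vec.tabulate f) ⟩
          ε                                                          ∎
          where
          open ℚ.≤-Reasoning
          μs = λ i → μ (S i) f
          0≤pT = proj₁ (pT∈[0,1] T T∈[0,1] f)
          pT≤1 = proj₂ (pT∈[0,1] T T∈[0,1] f)
          residual : pT T f - estimate cs μs ≡ ⟨ T̂ ⊖ cs , labelledBy f ⟩
          residual = trans (cong₂ _-_ (pT≡⟨T,labelledBy⟩ T f) (estimate-μ cs f)) (sym (⟨⊖⟩ T̂ cs (labelledBy f)))
          via-tabulate : ⟨ T̂ ⊖ cs , labelledBy (Vec.lookup (Vec.tabulate f)) ⟩ ≡ ⟨ T̂ ⊖ cs , labelledBy f ⟩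
          via-tabulate = ⟨⟩-congʳ (T̂ ⊖ cs) (labelledBy-cong (Vec.lookup∘tabulate f))

    trivial-approximation : 1ℚ ≤ ε → MeanApproximation T ε 0
    trivial-approximation 1≤ε = (λ ()) , (λ _ → 0ℚ) , (λ _ _ → ℚ.≤-refl , 0≤1) , λ f →
      let 0≤pT , pT≤1 = pT∈[0,1] T T∈[0,1] f in begin
        ∣ pT T f - 0ℚ ∣ ≡⟨ cong ∣_∣ (ℚ.+-identityʳ (pT T f)) ⟩
        ∣ pT T f ∣      ≡⟨ ℚ.0≤p⇒∣p∣≡p 0≤pT ⟩
        pT T f          ≤⟨ pT≤1 ⟩
        1ℚ              ≤⟨ 1≤ε ⟩
        ε               ∎
      where open ℚ.≤-Reasoning

module _ {a d-1 : ℕ} .{c : Coprime.Coprime a (suc d-1)} where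

  fromℕ≤mkℚ : ∀ {k} → k ℕ.* suc d-1 ℕ.≤ a → fromℕ k ≤ mkℚ (ℤ.+ a) d-1 c
  fromℕ≤mkℚ {k} kD≤a = subst (_≤ mkℚ (ℤ.+ a) d-1 c) (sym (fromℕ≡mkℚ k))
    (*≤* (subst₂ ℤ._≤_ (ℤ.pos-* k (suc d-1)) (sym (ℤ.*-identityʳ (ℤ.+ a))) (ℤ.+≤+ kD≤a)))

  fromℕ≤mkℚ⁻¹ : ∀ {k} → fromℕ k ≤ mkℚ (ℤ.+ a) d-1 c → k ℕ.* suc d-1 ℕ.≤ a
  fromℕ≤mkℚ⁻¹ {k} k≤q = ℤ.drop‿+≤+ (subst₂ ℤ._≤_ (sym (ℤ.pos-* k (suc d-1))) (ℤ.*-identityʳ (ℤ.+ a))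
    (ℚ.drop-*≤* (subst (_≤ mkℚ (ℤ.+ a) d-1 c) (fromℕ≡mkℚ k) k≤q)))

  mkℚ≤fromℕ : ∀ {k} → a ℕ.≤ k ℕ.* suc d-1 → mkℚ (ℤ.+ a) d-1 c ≤ fromℕ k
  mkℚ≤fromℕ {k} a≤kD = subst (mkℚ (ℤ.+ a) d-1 c ≤_) (sym (fromℕ≡mkℚ k))
    (*≤* (subst₂ ℤ._≤_ (sym (ℤ.*-identityʳ (ℤ.+ a))) (ℤ.pos-* k (suc d-1)) (ℤ.+≤+ a≤kD)))

fromℕ-ceiling : ∀ q → 0ℚ ≤ q → ∃[ k ] q ≤ fromℕ k × fromℕ k ≤ 1ℚ + q
fromℕ-ceiling q@(mkℚ (ℤ.+ a) d-1 c) _ = suc j , mkℚ≤fromℕ {k = suc j} a≤[1+j]D , [1+j]≤1+q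
  where
  D = suc d-1
  j = a ℕ./ D
  a≤[1+j]D : a ℕ.≤ suc j ℕ.* D
  a≤[1+j]D = ℕ.≤-trans (ℕ.≤-reflexive (ℕ.m≡m%n+[m/n]*n a D)) (ℕ.+-monoˡ-≤ (j ℕ.* D) (ℕ.<⇒≤ (ℕ.m%n<n a D)))
  [1+j]≤1+q : fromℕ (suc j) ≤ 1ℚ + q
  [1+j]≤1+q = subst (_≤ 1ℚ + q) (sym (fromℕ-suc j)) (ℚ.+-monoʳ-≤ 1ℚ (fromℕ≤mkℚ {c = c} {k = j} (ℕ.m/n*n≤m a D)))
fromℕ-ceiling (mkℚ ℤ.-[1+ _ ] _ _) (*≤* ())

n<2^n : ∀ n → n ℕ.< 2 ℕ.^ n
n<2^n zero    = s≤s z≤n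
n<2^n (suc n) = ℕ.+-mono-≤ (ℕ.m^n>0 2 n) (ℕ.≤-trans (n<2^n n) (ℕ.≤-reflexive (sym (ℕ.+-identityʳ (2 ℕ.^ n)))))

fromℕ≤⇒≤2^ : ∀ m x → fromℕ m ≤ x → m ≤2^ x
fromℕ≤⇒≤2^ m (mkℚ (ℤ.+ a) d-1 _) m≤x = begin
  m ℕ.^ suc d-1                 ≤⟨ ℕ.^-monoˡ-≤ (suc d-1) (ℕ.<⇒≤ (n<2^n m)) ⟩
  (2 ℕ.^ m) ℕ.^ suc d-1         ≡⟨ ℕ.^-*-assoc 2 m (suc d-1) ⟩
  2 ℕ.^ (m ℕ.* suc d-1)         ≤⟨ ℕ.^-monoʳ-≤ 2 (fromℕ≤mkℚ⁻¹ {k = m} m≤x) ⟩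
  2 ℕ.^ a                       ∎
  where open ℕ.≤-Reasoning
fromℕ≤⇒≤2^ m (mkℚ ℤ.-[1+ _ ] _ _) m≤x with ℚ.≤-trans (fromℕ-nonNeg m) m≤x
... | *≤* ()

0<p⇒0≤1/p : ∀ p .{{_ : ℚ.NonZero p}} → 0ℚ < p → 0ℚ ≤ 1/ p
0<p⇒0≤1/p (mkℚ ℤ.+[1+ _ ] _ _) _              = *≤* (ℤ.+≤+ z≤n)
0<p⇒0≤1/p (mkℚ (ℤ.+ 0) _ _)    (*<* (ℤ.+<+ ()))
0<p⇒0≤1/p (mkℚ ℤ.-[1+ _ ] _ _) (*<* ())

module _ {ε} (0<ε : 0ℚ < ε) where

  private
    instance
      ε≢0 : ℚ.NonZero ε
      ε≢0 = ℚ.>-nonZero 0<ε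

    0≤1/ε : 0ℚ ≤ 1/ ε
    0≤1/ε = 0<p⇒0≤1/p ε 0<ε

    cancel : ∀ a → a * (1/ ε * ε) * (1/ ε * ε) ≡ a
    cancel a = trans (cong (λ x → a * x * x) (ℚ.*-inverseˡ ε)) (trans (ℚ.*-identityʳ (a * 1ℚ)) (ℚ.*-identityʳ a))

  ÷ε÷ε*ε*ε : ∀ a → a ÷ ε ÷ ε * (ε * ε) ≡ a
  ÷ε÷ε*ε*ε a = trans (regroup a (1/ ε) ε) (cancel a)
    where
    regroup : ∀ a i e → a * i * i * (e * e) ≡ a * (i * e) * (i * e)
    regroup = solve 3 (λ a i e → a :* i :* i :* (e :* e) := a :* (i :* e) :* (i :* e)) refl

  ≤÷ε÷ε : ∀ {p q} → p * (ε * ε) ≤ q → p ≤ q ÷ ε ÷ ε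
  ≤÷ε÷ε {p} {q} pε²≤q = subst (_≤ q ÷ ε ÷ ε) (trans (regroup p (1/ ε) ε) (cancel p))
    (ℚ.*-monoʳ-≤-nonNeg (1/ ε) {{ℚ.nonNegative 0≤1/ε}} (ℚ.*-monoʳ-≤-nonNeg (1/ ε) {{ℚ.nonNegative 0≤1/ε}} pε²≤q))
    where
    regroup : ∀ a i e → a * (e * e) * i * i ≡ a * (i * e) * (i * e)
    regroup = solve 3 (λ a i e → a :* (e :* e) :* i :* i := a :* (i :* e) :* (i :* e)) refl

  steps-bound : ε ≤ 1ℚ → ∀ s → ∃[ k ] fromℕ (2 ℕ.^ s) ≤ fromℕ k * (ε * ε) × fromℕ (2 ℕ.* k) ≤ expo (fromℕ 4) s ε 0<ε
  steps-bound ε≤1 s = bound (fromℕ-ceiling q 0≤q)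
    where
    P = fromℕ (2 ℕ.^ s)
    q = P ÷ ε ÷ ε
    0≤q : 0ℚ ≤ q
    0≤q = ≤÷ε÷ε (subst (_≤ P) (sym (ℚ.*-zeroˡ (ε * ε))) (fromℕ-nonNeg (2 ℕ.^ s)))
    0≤ε² = 0≤p*p ε

    2[1+2^s]≤4*4^s : 2 ℕ.* (1 ℕ.+ 2 ℕ.^ s) ℕ.≤ 4 ℕ.* 2 ℕ.^ (2 ℕ.* s)
    2[1+2^s]≤4*4^s = ℕ.≤-trans (ℕ.*-monoʳ-≤ 2 (ℕ.+-mono-≤ (ℕ.m^n>0 2 (2 ℕ.* s)) 2^s≤4^s))
                               (ℕ.≤-reflexive (sym (ℕ.*-assoc 2 2 (2 ℕ.^ (2 ℕ.* s)))))
      where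
      2^s≤4^s : 2 ℕ.^ s ℕ.≤ 2 ℕ.^ (2 ℕ.* s) ℕ.+ 0
      2^s≤4^s = ℕ.≤-trans (ℕ.^-monoʳ-≤ 2 (ℕ.m≤m+n s (s ℕ.+ 0))) (ℕ.≤-reflexive (sym (ℕ.+-identityʳ _)))

    bound : ∃[ k ] q ≤ fromℕ k × fromℕ k ≤ 1ℚ + q →
            ∃[ k ] P ≤ fromℕ k * (ε * ε) × fromℕ (2 ℕ.* k) ≤ expo (fromℕ 4) s ε 0<ε
    bound (k , q≤k , k≤1+q) = k , enough , ≤÷ε÷ε small
      where
      enough : P ≤ fromℕ k * (ε * ε)
      enough = subst (_≤ fromℕ k * (ε * ε)) (÷ε÷ε*ε*ε P) (ℚ.*-monoʳ-≤-nonNeg (ε * ε) {{ℚ.nonNegative 0≤ε²}} q≤k)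
      small : fromℕ (2 ℕ.* k) * (ε * ε) ≤ fromℕ 4 * fromℕ (2 ℕ.^ (2 ℕ.* s))
      small = begin
        fromℕ (2 ℕ.* k) * (ε * ε)        ≡⟨ cong (_* (ε * ε)) (fromℕ-* 2 k) ⟩
        fromℕ 2 * fromℕ k * (ε * ε)      ≡⟨ ℚ.*-assoc (fromℕ 2) (fromℕ k) (ε * ε) ⟩
        fromℕ 2 * (fromℕ k * (ε * ε))    ≤⟨ ℚ.*-monoˡ-≤-nonNeg (fromℕ 2) (ℚ.*-monoʳ-≤-nonNeg (ε * ε) {{ℚ.nonNegative 0≤ε²}} k≤1+q) ⟩
        fromℕ 2 * ((1ℚ + q) * (ε * ε))   ≡⟨ cong (fromℕ 2 *_) (trans (distrib q (ε * ε)) (cong (ε * ε +_) (÷ε÷ε*ε*ε P))) ⟩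
        fromℕ 2 * (ε * ε + P)            ≤⟨ ℚ.*-monoˡ-≤-nonNeg (fromℕ 2) (ℚ.+-monoˡ-≤ P (p*p≤1 (ℚ.<⇒≤ 0<ε) ε≤1)) ⟩
        fromℕ 2 * (1ℚ + P)               ≡⟨ cong (fromℕ 2 *_) (fromℕ-suc (2 ℕ.^ s)) ⟨
        fromℕ 2 * fromℕ (1 ℕ.+ 2 ℕ.^ s)  ≡⟨ fromℕ-* 2 (1 ℕ.+ 2 ℕ.^ s) ⟨
        fromℕ (2 ℕ.* (1 ℕ.+ 2 ℕ.^ s))     ≤⟨ fromℕ-mono-≤ 2[1+2^s]≤4*4^s ⟩
        fromℕ (4 ℕ.* 2 ℕ.^ (2 ℕ.* s))     ≡⟨ fromℕ-* 4 (2 ℕ.^ (2 ℕ.* s)) ⟩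
        fromℕ 4 * fromℕ (2 ℕ.^ (2 ℕ.* s)) ∎
        where
        open ℚ.≤-Reasoning
        distrib : ∀ q e → (1ℚ + q) * e ≡ e + q * e
        distrib = solve 2 (λ q e → (con 1ℚ :+ q) :* e := e :+ q :* e) refl

-- Bounding the number of greedy steps needs ε ≤ 1; for ε ≥ 1 the constant 0 is already ε-close.
testerApproximation : ∀ n s .{{_ : NonZero n}} (T : Tester n s) → (∀ xs ys → (0ℚ ≤ T xs ys) × (T xs ys ≤ 1ℚ)) →
  ∀ ε (0<ε : 0ℚ < ε) → Σ[ m ∈ ℕ ] m ≤2^ expo (fromℕ 4) s ε 0<ε × MeanApproximation T ε m
testerApproximation n s T T∈[0,1] ε 0<ε with 1ℚ ℚ.≤? ε
... | yes 1≤ε = 0 , z≤n , trivial-approximation T T∈[0,1] 0<ε 1≤ε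
  where open Samples n s
... | no  1≰ε = fewSteps (steps-bound 0<ε (ℚ.<⇒≤ (ℚ.≰⇒> 1≰ε)) s)
  where
  open Samples n s
  fewSteps : ∃[ k ] fromℕ (2 ℕ.^ s) ≤ fromℕ k * (ε * ε) × fromℕ (2 ℕ.* k) ≤ expo (fromℕ 4) s ε 0<ε →
             Σ[ m ∈ ℕ ] m ≤2^ expo (fromℕ 4) s ε 0<ε × MeanApproximation T ε m
  fewSteps (k , enough , 2k≤expo) = weaken (approximation T T∈[0,1] 0<ε k enough)
    where
    weaken : Σ[ m ∈ ℕ ] m ℕ.≤ 2 ℕ.* k × MeanApproximation T ε m →
             Σ[ m ∈ ℕ ] m ≤2^ expo (fromℕ 4) s ε 0<ε × MeanApproximation T ε m
    weaken (m , m≤2k , approx) = m , fromℕ≤⇒≤2^ m _ (ℚ.≤-trans (fromℕ-mono-≤ m≤2k) 2k≤expo) , approx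

lemma2p3 : Σ ℚ λ C → (0ℚ < C) ×
    ((n : ℕ) → 1 ℕ.≤ n → (s : ℕ) → 1 ℕ.≤ s → (ε : ℚ) → (ε>0 : 0ℚ < ε) →
     (T : Tester n s) →
     ((xs : _) → (ys : _) → (0ℚ ≤ T xs ys) × (T xs ys ≤ 1ℚ)) →
     Σ ℕ λ m → (m ≤2^ expo C s ε ε>0) ×
       Σ (Fin m → Subset n) λ S →
       Σ ((Fin m → ℚ) → ℚ) λ φ →
         ((v : Fin m → ℚ) → ((i : Fin m) → (0ℚ ≤ v i) × (v i ≤ 1ℚ)) →
            (0ℚ ≤ φ v) × (φ v ≤ 1ℚ)) ×
         ((f : Fin n → Bool) →
            ∣ pT T f - φ (λ i → μ (S i) f) ∣ ≤ ε))
lemma2p3 = fromℕ 4 , *<* (ℤ.+<+ (s≤s z≤n)) , λ where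
  (suc n) _ s _ ε 0<ε T T∈[0,1] → testerApproximation (suc n) s T T∈[0,1] ε 0<ε
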